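{- Let $q$ be a prime power, $r$ a positive integer, $d$ a positive divisor of $q+1$, $\epsilon\in\mathbb F_{q^2}^*$ of order $d$. Let $b\in\mathbb F_{q^2}^*$ and integers $0<j_1<d$, $0\le j_2<d$, $0<i_2<(q+1)/d$ (so $h(X)=1-X^{j_1(q+1)/d}+bX^{i_2+j_2(q+1)/d}$). Let $0\le k<d$ with $j_1k\equiv0\pmod d$, and set $L_k=b\epsilon^{j_2k}$ (a constant polynomial), $s_k=i_2$, $t_k=0$. Suppose $\tau_k$ is an integer in $\{0\}\cup[(q+1)/d-t_k,t_k]$ and $\lambda_k\in\mu_{q+1}$ with $L_k\in\mathcal L_k(t_k,\tau_k;\lambda_k)$; let $\pi(k)\in\mathbb Z/d\mathbb Z$ with $\lambda_k^{(q+1)/d}=\epsilon^{\pi(k)}$ and $e_k=r-2s_k-t_k+\tau_k$. Then $\tau_k=0$, $e_k=r-2i_2$, and $$\pi(k)=-2j_2k\frac{q+1}d+\beta\quad\text{in }\mathbb Z/d\mathbb Z,$$ where $\beta\in\mathbb Z/d\mathbb Z$ is given by $b^{(q^2-1)/d}=\epsilon^\beta$.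
   Context: $\mu_{q+1}=\{x\in\mathbb F_{q^2}^*:x^{q+1}=1\}$. For $a\in\mathbb F_{q^2}$, $\bar a=a^q$; for $f=\sum_{i=0}^na_iX^i$ with $a_n\ne0$, $\tilde f(X)=\sum_{i=0}^n\bar a_iX^{n-i}$. For $0\le k<d$, $0\le t<(q+1)/d$, $\lambda\in\mu_{q+1}$: $\mathcal L_k(t,0;\lambda)$ is the set of $L\in\mathbb F_{q^2}[X]$ with $\deg L=t$, $\tilde L=\lambda L$ and $\gcd(L,X^{(q+1)/d}-\epsilon^k)=1$; for integers $\tau$ with $(q+1)/d-t\le\tau\le t$, $\mathcal L_k(t,\tau;\lambda)$ is the set of $L=P+X^{(q+1)/d-\tau}Q$ with $P,Q\in\mathbb F_{q^2}[X]$, $\deg P=t-\tau$, $\tilde P=\lambda P$, $\deg Q=\tau+t-(q+1)/d$, $\tilde Q=\lambda\epsilon^kQ$, $\gcd(L,X^{(q+1)/d}-\epsilon^k)=1$. -}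

module Defs where

open import Level using (0ℓ)
open import Data.Nat using (ℕ; zero; suc; _∸_; _<_)
open import Data.Fin using (Fin)
open import Data.List using (List; []; _∷_; [_]; map; upTo; replicate; _++_)
open import Data.Product using (_×_; Σ; ∃; ∃-syntax)
open import Data.Sum using (_⊎_)
open import Data.Integer as ℤ using (ℤ; +_; ∣_∣)
open import Relation.Binary.PropositionalEquality using (_≡_; _≢_)
open import Algebra.Structures using (IsCommutativeRing)
open import Function.Bundles using (_↔_)

record FField (N : ℕ) : Set₁ where
  infixl 6 _+F_
  infixl 7 _*F_
  field
    Carrier  : Set
    _+F_ _*F_ : Carrier → Carrier → Carrier
    -F_      : Carrier → Carrier
    0# 1#    : Carrier
    isCommutativeRing : IsCommutativeRing _≡_ _+F_ _*F_ -F_ 0# 1#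
    0≢1      : 0# ≢ 1#
    inverse  : ∀ x → x ≢ 0# → ∃[ y ] (x *F y ≡ 1#)
    card     : Carrier ↔ Fin N

module FieldDefs {N : ℕ} (F : FField N) (q : ℕ) where
  open FField F public

  pow : Carrier → ℕ → Carrier
  pow x zero    = 1#
  pow x (suc n) = x *F pow x n

  conj : Carrier → Carrier
  conj a = pow a q

  -- polynomials as coefficient lists a₀, a₁, … (trailing zeros allowed)
  Poly : Set
  Poly = List Carrier

  coeff : Poly → ℕ → Carrier
  coeff []       _       = 0#
  coeff (a ∷ A)  zero    = a
  coeff (a ∷ A)  (suc i) = coeff A i

  _≈P_ : Poly → Poly → Set
  A ≈P B = ∀ i → coeff A i ≡ coeff B i

  _+P_ : Poly → Poly → Poly
  []      +P B       = B
  (a ∷ A) +P []      = a ∷ A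
  (a ∷ A) +P (b ∷ B) = (a +F b) ∷ (A +P B)

  scale : Carrier → Poly → Poly
  scale c A = map (c *F_) A

  _*P_ : Poly → Poly → Poly
  []      *P B = []
  (a ∷ A) *P B = scale a B +P (0# ∷ (A *P B))

  shift : ℕ → Poly → Poly
  shift n A = replicate n 0# ++ A

  Xpow : ℕ → Poly
  Xpow n = shift n [ 1# ]

  HasDeg : Poly → ℕ → Set
  HasDeg A n = (∀ i → n < i → coeff A i ≡ 0#) × coeff A n ≢ 0#

  tilde : ℕ → Poly → Poly
  tilde n A = map (λ i → conj (coeff A (n ∸ i))) (upTo (suc n))

  _∣P_ : Poly → Poly → Set
  D ∣P A = ∃[ C ] ((D *P C) ≈P A)

  GcdOne : Poly → Poly → Set
  GcdOne A B = ∀ D → D ∣P A → D ∣P B → D ∣P [ 1# ]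

  XmMinus : ℕ → Carrier → Poly
  XmMinus m c = Xpow m +P [ -F c ]

  -- The set 𝓛_k(t, τ; λ), with m = (q+1)/d and c = ε^k.
  InL : (m : ℕ) (c : Carrier) (t : ℕ) (τ : ℤ) (λ₀ : Carrier) → Poly → Set
  InL m c t τ λ₀ L =
      (τ ≡ + 0 × HasDeg L t × (tilde t L ≈P scale λ₀ L) × GcdOne L (XmMinus m c))
    ⊎ (((+ m ℤ.- + t) ℤ.≤ τ) × (τ ℤ.≤ + t) ×
        ∃[ P ] ∃[ Q ] ∃[ dP ] ∃[ dQ ]
          ( (+ dP ≡ + t ℤ.- τ) × HasDeg P dP × (tilde dP P ≈P scale λ₀ P)
          × (+ dQ ≡ (τ ℤ.+ + t) ℤ.- + m) × HasDeg Q dQ × (tilde dQ Q ≈P scale (λ₀ *F c) Q)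
          × (L ≈P (P +P shift ∣ + m ℤ.- τ ∣ Q))
          × GcdOne L (XmMinus m c)))

{-# OPTIONS --safe #-}
-- L_k is the nonzero constant c = b εᵉ with e = j₂k, so it can only lie in the τ = 0 part of
-- 𝓛_k (the other part needs (q+1)/d ≤ τ ≤ 0), and there tilde L = λL reads c^q = λc, i.e.
-- λ = c^(q-1). Hence λ^m = b^((q²-1)/d) ε^(e(q-1)m) = ε^β ε^(e(q-1)m) with m = (q+1)/d, and
-- adding 2em to the exponent gives e(q+1)m = d·em², a multiple of the order d of ε.
module Submission where

open import Defs
open import Level using (0ℓ)
open import Data.Nat using (ℕ; zero; suc; pred; _+_; _*_; _∸_; _^_; _≤_; _<_; _/_; _%_; NonZero)
import Data.Nat.Properties as ℕP
open import Data.Nat.DivMod using (m≡m%n+[m/n]*n; m%n<n; m*n/n≡m; m/n*n≡m)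
open import Data.Nat.Divisibility using (_∣_)
open import Data.Nat.Primality using (Prime; prime⇒nonZero)
open import Data.Nat.Solver using (module +-*-Solver)
open import Data.Fin using (Fin; toℕ)
open import Data.Fin.Properties using (toℕ<n)
open import Data.List using ([_])
open import Data.Product using (_×_; _,_; proj₁; proj₂)
open import Data.Sum using (_⊎_; inj₁; inj₂)
open import Data.Empty using (⊥-elim)
open import Data.Integer as ℤ using (ℤ; +_)
import Data.Integer.Properties as ℤP
open import Relation.Binary using (tri<; tri≈; tri>)
open import Relation.Binary.PropositionalEquality
  using (_≡_; _≢_; refl; sym; trans; cong; cong₂; module ≡-Reasoning)
open import Algebra.Bundles using (CommutativeSemiring)
open import Algebra.Structures using (IsCommutativeRing)

q*q∸1≡pred[q]*[q+1] : ∀ q → q * q ∸ 1 ≡ pred q * (q + 1)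
q*q∸1≡pred[q]*[q+1] zero     = refl
q*q∸1≡pred[q]*[q+1] (suc q′) =
  solve 1 (λ q′ → q′ :+ q′ :* (con 1 :+ q′) := q′ :* (con 1 :+ q′ :+ con 1)) refl q′
  where open +-*-Solver

[q*q∸1]/d≡pred[q]*m : ∀ q m d .{{_ : NonZero d}} → m * d ≡ q + 1 → (q * q ∸ 1) / d ≡ pred q * m
[q*q∸1]/d≡pred[q]*m q m d md≡q+1 = begin
  (q * q ∸ 1) / d        ≡⟨ cong (_/ d) (q*q∸1≡pred[q]*[q+1] q) ⟩
  pred q * (q + 1) / d   ≡⟨ cong (λ n → pred q * n / d) md≡q+1 ⟨
  pred q * (m * d) / d   ≡⟨ cong (_/ d) (ℕP.*-assoc (pred q) m d) ⟨
  pred q * m * d / d     ≡⟨ m*n/n≡m (pred q * m) d ⟩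
  pred q * m             ∎
  where open ≡-Reasoning

e*[pred[q]*m]+2*e*m≡d*[e*[m*m]] : ∀ q m d e .{{_ : NonZero q}} → m * d ≡ q + 1 →
  e * (pred q * m) + 2 * e * m ≡ d * (e * (m * m))
e*[pred[q]*m]+2*e*m≡d*[e*[m*m]] (suc q′) m d e md≡q+1 = begin
  e * (q′ * m) + 2 * e * m  ≡⟨ solve 3 (λ q′ m e → e :* (q′ :* m) :+ con 2 :* e :* m
                                          := e :* m :* (con 1 :+ q′ :+ con 1)) refl q′ m e ⟩
  e * m * (suc q′ + 1)      ≡⟨ cong (e * m *_) md≡q+1 ⟨
  e * m * (m * d)           ≡⟨ solve 3 (λ m d e → e :* m :* (m :* d) := d :* (e :* (m :* m))) refl m d e ⟩
  d * (e * (m * m))         ∎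
  where
  open ≡-Reasoning
  open +-*-Solver

module FieldExp {N : ℕ} (F : FField N) where
  open FField F
  open IsCommutativeRing isCommutativeRing using (*-assoc; *-comm; *-identityˡ; *-identityʳ; zeroʳ)
  open ≡-Reasoning

  commutativeSemiring : CommutativeSemiring 0ℓ 0ℓ
  commutativeSemiring = record
    { isCommutativeSemiring = IsCommutativeRing.isCommutativeSemiring isCommutativeRing }

  open import Algebra.Properties.CommutativeSemiring.Exp commutativeSemiring
    using (^-homo-*; ^-assocʳ; ^-distrib-*) renaming (_^_ to infixr 8 _^F_) public

  *-cancelˡ : ∀ {x y z} → x ≢ 0# → x *F y ≡ x *F z → y ≡ z
  *-cancelˡ {x} {y} {z} x≢0 xy≡xz with inverse x x≢0
  ... | x⁻¹ , xx⁻¹≡1 = begin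
    y                ≡⟨ *-identityˡ y ⟨
    1# *F y          ≡⟨ cong (_*F y) (trans (sym xx⁻¹≡1) (*-comm x x⁻¹)) ⟩
    (x⁻¹ *F x) *F y  ≡⟨ *-assoc x⁻¹ x y ⟩
    x⁻¹ *F (x *F y)  ≡⟨ cong (x⁻¹ *F_) xy≡xz ⟩
    x⁻¹ *F (x *F z)  ≡⟨ *-assoc x⁻¹ x z ⟨
    (x⁻¹ *F x) *F z  ≡⟨ cong (_*F z) (trans (*-comm x⁻¹ x) xx⁻¹≡1) ⟩
    1# *F z          ≡⟨ *-identityˡ z ⟩
    z                ∎

  x≢0∧y≢0⇒xy≢0 : ∀ {x y} → x ≢ 0# → y ≢ 0# → x *F y ≢ 0#
  x≢0∧y≢0⇒xy≢0 {x} x≢0 y≢0 xy≡0 = y≢0 (*-cancelˡ x≢0 (trans xy≡0 (sym (zeroʳ x))))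

  x≢0⇒x^n≢0 : ∀ {x} n → x ≢ 0# → x ^F n ≢ 0#
  x≢0⇒x^n≢0 zero    x≢0 1≡0 = 0≢1 (sym 1≡0)
  x≢0⇒x^n≢0 (suc n) x≢0     = x≢0∧y≢0⇒xy≢0 x≢0 (x≢0⇒x^n≢0 n x≢0)

  1^n≡1 : ∀ n → 1# ^F n ≡ 1#
  1^n≡1 zero    = refl
  1^n≡1 (suc n) = trans (*-identityˡ _) (1^n≡1 n)

  x^[1+n]≡λx⇒λ≡x^n : ∀ {x λ₀} n → x ≢ 0# → x ^F suc n ≡ λ₀ *F x → λ₀ ≡ x ^F n
  x^[1+n]≡λx⇒λ≡x^n {x} {λ₀} n x≢0 x^[1+n]≡λx =
    sym (*-cancelˡ x≢0 (trans x^[1+n]≡λx (*-comm λ₀ x)))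

  HasOrder : Carrier → ℕ → Set
  HasOrder x d = x ^F d ≡ 1# × (∀ i → 0 < i → i < d → x ^F i ≢ 1#)

  module _ {x d} (ord : HasOrder x d) where
    private
      x^d≡1 = proj₁ ord

    x^[d*n]≡1 : ∀ n → x ^F (d * n) ≡ 1#
    x^[d*n]≡1 n = begin
      x ^F (d * n)     ≡⟨ ^-assocʳ x d n ⟨
      (x ^F d) ^F n    ≡⟨ cong (_^F n) x^d≡1 ⟩
      1# ^F n          ≡⟨ 1^n≡1 n ⟩
      1#               ∎

    x^[a+d*n]≡x^a : ∀ a n → x ^F (a + d * n) ≡ x ^F a
    x^[a+d*n]≡x^a a n = begin
      x ^F (a + d * n)          ≡⟨ ^-homo-* x a (d * n) ⟩
      x ^F a *F x ^F (d * n)    ≡⟨ cong (x ^F a *F_) (x^[d*n]≡1 n) ⟩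
      x ^F a *F 1#              ≡⟨ *-identityʳ _ ⟩
      x ^F a                    ∎

    private
      x^a≢x^b : ∀ {a b} → x ≢ 0# → a < b → b < d → x ^F a ≢ x ^F b
      x^a≢x^b {a} {b} x≢0 a<b b<d x^a≡x^b =
        proj₂ ord (b ∸ a) (ℕP.m<n⇒0<n∸m a<b) (ℕP.≤-<-trans (ℕP.m∸n≤m b a) b<d)
          (sym (*-cancelˡ (x≢0⇒x^n≢0 a x≢0) (begin
            x ^F a *F 1#             ≡⟨ *-identityʳ _ ⟩
            x ^F a                   ≡⟨ x^a≡x^b ⟩
            x ^F b                   ≡⟨ cong (x ^F_) (ℕP.m+[n∸m]≡n (ℕP.<⇒≤ a<b)) ⟨
            x ^F (a + (b ∸ a))       ≡⟨ ^-homo-* x a (b ∸ a) ⟩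
            x ^F a *F x ^F (b ∸ a)   ∎)))

    ^F-injective-<order : ∀ {a b} → x ≢ 0# → a < d → b < d → x ^F a ≡ x ^F b → a ≡ b
    ^F-injective-<order {a} {b} x≢0 a<d b<d x^a≡x^b with ℕP.<-cmp a b
    ... | tri< a<b _ _ = ⊥-elim (x^a≢x^b x≢0 a<b b<d x^a≡x^b)
    ... | tri≈ _ a≡b _ = a≡b
    ... | tri> _ _ b<a = ⊥-elim (x^a≢x^b x≢0 b<a a<d (sym x^a≡x^b))

    x^a≡x^b⇒a%d≡b : .{{_ : NonZero d}} → ∀ {a b} → x ≢ 0# → b < d → x ^F a ≡ x ^F b → a % d ≡ b
    x^a≡x^b⇒a%d≡b {a} {b} x≢0 b<d x^a≡x^b = ^F-injective-<order x≢0 (m%n<n a d) b<d (begin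
      x ^F (a % d)                  ≡⟨ x^[a+d*n]≡x^a (a % d) (a / d) ⟨
      x ^F (a % d + d * (a / d))    ≡⟨ cong (λ n → x ^F (a % d + n)) (ℕP.*-comm d (a / d)) ⟩
      x ^F (a % d + a / d * d)      ≡⟨ cong (x ^F_) (m≡m%n+[m/n]*n a d) ⟨
      x ^F a                        ≡⟨ x^a≡x^b ⟩
      x ^F b                        ∎)

    -- c^q = λ₀ c is the condition tilde c = λ₀ c for the constant polynomial c.
    eigenvalue-exponent : ∀ {q m} .{{_ : NonZero d}} .{{_ : NonZero q}} → x ≢ 0# → m * d ≡ q + 1 →
      ∀ {b c λ₀} e {π β} → b ≢ 0# → β < d → c ≡ b *F x ^F e →
      c ^F q ≡ λ₀ *F c → λ₀ ^F m ≡ x ^F π → b ^F ((q * q ∸ 1) / d) ≡ x ^F β →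
      (π + 2 * e * m) % d ≡ β
    eigenvalue-exponent {suc q′} {m} x≢0 md≡q+1 {b} {_} {λ₀} e {π} {β} b≢0 β<d refl c^q≡λc λ^m≡x^π b^…≡x^β =
      x^a≡x^b⇒a%d≡b x≢0 β<d (begin
        x ^F (π + 2 * e * m)                        ≡⟨ ^-homo-* x π (2 * e * m) ⟩
        x ^F π *F x ^F (2 * e * m)                  ≡⟨ cong (_*F x ^F (2 * e * m)) x^π≡x^β*x^[e*q′*m] ⟩
        (x ^F β *F x ^F (e * (q′ * m))) *F x ^F (2 * e * m)
                                                    ≡⟨ *-assoc _ _ _ ⟩
        x ^F β *F (x ^F (e * (q′ * m)) *F x ^F (2 * e * m))
                                                    ≡⟨ cong (x ^F β *F_) (^-homo-* x (e * (q′ * m)) (2 * e * m)) ⟨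
        x ^F β *F x ^F (e * (q′ * m) + 2 * e * m)   ≡⟨ cong (λ n → x ^F β *F x ^F n)
                                                         (e*[pred[q]*m]+2*e*m≡d*[e*[m*m]] (suc q′) m d e md≡q+1) ⟩
        x ^F β *F x ^F (d * (e * (m * m)))          ≡⟨ ^-homo-* x β _ ⟨
        x ^F (β + d * (e * (m * m)))                ≡⟨ x^[a+d*n]≡x^a β _ ⟩
        x ^F β                                      ∎)
      where
      c = b *F x ^F e
      x^π≡x^β*x^[e*q′*m] : x ^F π ≡ x ^F β *F x ^F (e * (q′ * m))
      x^π≡x^β*x^[e*q′*m] = begin
        x ^F π                                   ≡⟨ λ^m≡x^π ⟨
        λ₀ ^F m                                  ≡⟨ cong (_^F m) (x^[1+n]≡λx⇒λ≡x^n q′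
                                                      (x≢0∧y≢0⇒xy≢0 b≢0 (x≢0⇒x^n≢0 e x≢0)) c^q≡λc) ⟩
        (c ^F q′) ^F m                           ≡⟨ ^-assocʳ c q′ m ⟩
        c ^F (q′ * m)                            ≡⟨ ^-distrib-* b (x ^F e) (q′ * m) ⟩
        b ^F (q′ * m) *F (x ^F e) ^F (q′ * m)    ≡⟨ cong₂ _*F_ b^[q′*m]≡x^β (^-assocʳ x e (q′ * m)) ⟩
        x ^F β *F x ^F (e * (q′ * m))            ∎
        where
        b^[q′*m]≡x^β : b ^F (q′ * m) ≡ x ^F β
        b^[q′*m]≡x^β =
          trans (cong (b ^F_) (sym ([q*q∸1]/d≡pred[q]*m (suc q′) m d md≡q+1))) b^…≡x^β

module Conjugation {N : ℕ} (F : FField N) (q : ℕ) where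
  open FieldDefs F q
  open FieldExp F using (_^F_)

  pow≡^F : ∀ x n → pow x n ≡ x ^F n
  pow≡^F x zero    = refl
  pow≡^F x (suc n) = cong (x *F_) (pow≡^F x n)

  pow≡pow⇒^F≡^F : ∀ x a y b → pow x a ≡ pow y b → x ^F a ≡ y ^F b
  pow≡pow⇒^F≡^F x a y b eq = trans (sym (pow≡^F x a)) (trans eq (pow≡^F y b))

  InL-constant : ∀ {m c τ λ₀ x} → 0 < m → InL m c 0 τ λ₀ [ x ] → τ ≡ + 0 × x ^F q ≡ λ₀ *F x
  InL-constant {x = x} _ (inj₁ (τ≡0 , _ , tilde≈λL , _)) = τ≡0 , trans (sym (pow≡^F x q)) (tilde≈λL 0)
  InL-constant {suc m} _ (inj₂ (m-0≤τ , τ≤0 , _)) with ℤP.≤-trans m-0≤τ τ≤0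
  ... | ℤ.+≤+ ()

lemma4p2 : (p n : ℕ) → Prime p → 1 ≤ n →
  let q = p ^ n in
  (r : ℕ) → 0 < r →
  (d : ℕ) → .{{_ : NonZero d}} → d ∣ q + 1 →
  let m = (q + 1) / d in
  (F : FField (q * q)) →
  let open FieldDefs F q in
  (ε : Carrier) → ε ≢ 0# → pow ε d ≡ 1# → (∀ i → 0 < i → i < d → pow ε i ≢ 1#) →
  (b : Carrier) → b ≢ 0# →
  (j₁ j₂ i₂ : ℕ) → 0 < j₁ → j₁ < d → j₂ < d → 0 < i₂ → i₂ < m →
  (k : ℕ) → k < d → (j₁ * k) % d ≡ 0 →
  let Lk = [ b *F pow ε (j₂ * k) ]
      sk = i₂
      tk = 0
  in
  (τ : ℤ) → (τ ≡ + 0 ⊎ (((+ m ℤ.- + tk) ℤ.≤ τ) × (τ ℤ.≤ + tk))) →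
  (λk : Carrier) → pow λk (q + 1) ≡ 1# →
  InL m (pow ε k) tk τ λk Lk →
  (π : Fin d) → pow λk m ≡ pow ε (toℕ π) →
  (β : Fin d) → pow b ((q * q ∸ 1) / d) ≡ pow ε (toℕ β) →
  let ek = ((+ r ℤ.- (+ 2 ℤ.* + sk)) ℤ.- + tk) ℤ.+ τ in
  (τ ≡ + 0) × (ek ≡ + r ℤ.- (+ 2 ℤ.* + i₂))
    × ((toℕ π + 2 * j₂ * k * m) % d ≡ toℕ β)
lemma4p2 p n p-prime _ r _ d d∣q+1 F ε ε≢0 ε^d≡1 ε-order b b≢0 _ j₂ i₂ _ _ _ 0<i₂ i₂<m k _ _
         τ _ λk _ Lk∈L π λ^m≡ε^π β b^…≡ε^β =
  τ≡0 , ek≡r-2i₂ , π-relation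
  where
  open FieldExp F
  open FieldDefs F (p ^ n) using (pow; _*F_)
  open Conjugation F (p ^ n)
  q = p ^ n
  m = (q + 1) / d
  instance
    q≢0 : NonZero q
    q≢0 = ℕP.m^n≢0 p n {{prime⇒nonZero p-prime}}
  Lk-constant : τ ≡ + 0 × (b *F pow ε (j₂ * k)) ^F q ≡ λk *F (b *F pow ε (j₂ * k))
  Lk-constant = InL-constant (ℕP.<-trans 0<i₂ i₂<m) Lk∈L
  τ≡0 : τ ≡ + 0
  τ≡0 = proj₁ Lk-constant
  ek≡r-2i₂ : ((+ r ℤ.- (+ 2 ℤ.* + i₂)) ℤ.- + 0) ℤ.+ τ ≡ + r ℤ.- (+ 2 ℤ.* + i₂)
  ek≡r-2i₂ rewrite τ≡0 = trans (ℤP.+-identityʳ _) (ℤP.+-identityʳ _)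
  ε-hasOrder : HasOrder ε d
  ε-hasOrder = pow≡pow⇒^F≡^F ε d ε 0 ε^d≡1 , λ i 0<i i<d ε^i≡1 → ε-order i 0<i i<d (trans (pow≡^F ε i) ε^i≡1)
  π-relation : (toℕ π + 2 * j₂ * k * m) % d ≡ toℕ β
  π-relation = trans (cong (λ e → (toℕ π + e * m) % d) (ℕP.*-assoc 2 j₂ k))
    (eigenvalue-exponent ε-hasOrder ε≢0 (m/n*n≡m d∣q+1) (j₂ * k) b≢0 (toℕ<n β)
      (cong (b *F_) (pow≡^F ε (j₂ * k))) (proj₂ Lk-constant)
      (pow≡pow⇒^F≡^F λk m ε (toℕ π) λ^m≡ε^π) (pow≡pow⇒^F≡^F b ((q * q ∸ 1) / d) ε (toℕ β) b^…≡ε^β))
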